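{- Let $k>1$ and $\ell>2$ be integers and let $\mathcal L$ be a mixed layout of $G(k,\ell)$ with linear order $\prec$. Let $(u,v)$ be an edge of $G(k-1,\ell)$ with $u\prec v$, and let $a,b,c$ be three distinct queue-attachments of $(u,v)$ in $\mathcal L$. Then $u\prec a\prec v$, $u\prec b\prec v$ and $u\prec c\prec v$.
   Context: For $\ell\ge 1$, $G(1,\ell)$ is a single edge; for $k>1$, $G(k,\ell)$ is obtained from $G(k-1,\ell)$ by attaching $\ell$ new vertices to each edge of $G(k-1,\ell)$, where attaching a new vertex $x$ to an edge $(v,w)$ means adding $x$ and the edges $(x,v),(x,w)$; $x$ is then called an attachment of $(v,w)$. A linear order is a total order $\prec$ of the vertex set. Two independent edges $(u_1,v_1),(u_2,v_2)$ with $u_i\prec v_i$ cross if $u_1\prec u_2\prec v_1\prec v_2$ and nest if $u_1\prec u_2\prec v_2\prec v_1$. A stack is a set of pairwise non-crossing edges; a queue is a set of pairwise non-nested edges. A mixed layout consists of a linear order of the vertices and a partition of the edges into one stack and one queue; edges in the stack (queue) are stack-edges (queue-edges). An attachment $x$ of $(v,w)$ (a vertex of $G(k,\ell)$ attached to $(v,w)$ in the construction) is a queue-attachment if both $(x,v)$ and $(x,w)$ are queue-edges. -}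

module Defs where

open import Data.Nat using (ℕ; zero; suc)
open import Data.Fin using (Fin)
open import Data.Bool using (Bool; true; false)
open import Data.Unit using (⊤)
open import Data.Sum using (_⊎_; inj₁; inj₂)
open import Data.Product using (_×_; _,_; proj₁; proj₂; ∃-syntax; Σ)
open import Relation.Binary.PropositionalEquality using (_≡_)
open import Relation.Binary.Structures using (IsStrictTotalOrder)
open import Relation.Nullary using (¬_)

-- Level index n = k - 1, so G(1,ℓ) is level 0.
-- Edges of level n:
--   level 0: the single edge;
--   level suc n: old edges (inj₁ e), and for every edge e of level n,
--   every i : Fin ℓ and side s : Bool the new edge from the attachment (e , i)
--   to the first (false) / second (true) endpoint of e.
Edge : ℕ → ℕ → Set
Edge ℓ zero = ⊤
Edge ℓ (suc n) = Edge ℓ n ⊎ (Edge ℓ n × Fin ℓ × Bool)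

-- Vertices of level n: level 0 has two vertices; level suc n has the old
-- vertices (inj₁) plus one new vertex (inj₂ (e , i)) for every edge e of
-- level n and i : Fin ℓ — the i-th attachment of e.
Vert : ℕ → ℕ → Set
Vert ℓ zero = Bool
Vert ℓ (suc n) = Vert ℓ n ⊎ (Edge ℓ n × Fin ℓ)

ends : (ℓ n : ℕ) → Edge ℓ n → Vert ℓ n × Vert ℓ n
ends ℓ zero _ = false , true
ends ℓ (suc n) (inj₁ e) = inj₁ (proj₁ (ends ℓ n e)) , inj₁ (proj₂ (ends ℓ n e))
ends ℓ (suc n) (inj₂ (e , i , false)) = inj₂ (e , i) , inj₁ (proj₁ (ends ℓ n e))
ends ℓ (suc n) (inj₂ (e , i , true)) = inj₂ (e , i) , inj₁ (proj₂ (ends ℓ n e))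

record MixedLayout (ℓ n : ℕ) : Set₁ where
  field
    _≺_ : Vert ℓ n → Vert ℓ n → Set
    isLinear : IsStrictTotalOrder _≡_ _≺_
    -- partition of the edges: true = stack-edge, false = queue-edge
    inStack : Edge ℓ n → Bool

  Oriented : Edge ℓ n → Vert ℓ n → Vert ℓ n → Set
  Oriented e u v = (ends ℓ n e ≡ (u , v) ⊎ ends ℓ n e ≡ (v , u)) × u ≺ v

  Cross : Edge ℓ n → Edge ℓ n → Set
  Cross e f = ∃[ u₁ ] ∃[ v₁ ] ∃[ u₂ ] ∃[ v₂ ]
    (Oriented e u₁ v₁ × Oriented f u₂ v₂ × u₁ ≺ u₂ × u₂ ≺ v₁ × v₁ ≺ v₂)

  Nest : Edge ℓ n → Edge ℓ n → Set
  Nest e f = ∃[ u₁ ] ∃[ v₁ ] ∃[ u₂ ] ∃[ v₂ ]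
    (Oriented e u₁ v₁ × Oriented f u₂ v₂ × u₁ ≺ u₂ × u₂ ≺ v₂ × v₂ ≺ v₁)

  field
    stackOK : ∀ e f → inStack e ≡ true → inStack f ≡ true → ¬ Cross e f
    queueOK : ∀ e f → inStack e ≡ false → inStack f ≡ false → ¬ Nest e f

QueueAttachment : {ℓ m : ℕ} → MixedLayout ℓ (suc m) → Edge ℓ m → Fin ℓ → Set
QueueAttachment L e i =
  MixedLayout.inStack L (inj₂ (e , i , false)) ≡ false ×
  MixedLayout.inStack L (inj₂ (e , i , true)) ≡ false

module Submission where

open import Defs
open import Data.Nat using (ℕ; suc; _<_)
open import Data.Fin using (Fin)
open import Data.Sum using (_⊎_; inj₁; inj₂; swap)
open import Data.Product using (_×_; _,_; Σ-syntax; proj₁; proj₂)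
open import Data.Bool using (false; true)
open import Data.Empty using (⊥; ⊥-elim)
open import Relation.Binary.PropositionalEquality using (_≡_; _≢_; refl; cong; ≢-sym)
open import Relation.Binary.Definitions using (tri<; tri≈; tri>)
open import Relation.Binary.Structures using (IsStrictTotalOrder)

-- A common queue-neighbour x of U ≺ V lies left of U, between U and V, or right
-- of V.  Any two of them, distinct, are either both between U and V or on
-- opposite sides: every other combination makes two of their four queue-edges
-- nest.  Hence three distinct ones leave no room outside the interval (U, V).

module QueueEdges {ℓ n : ℕ} (L : MixedLayout ℓ n) where
  open MixedLayout L
  open IsStrictTotalOrder isLinear using (compare; trans)

  QueueEdge : Vert ℓ n → Vert ℓ n → Set
  QueueEdge p q =
    Σ[ f ∈ Edge ℓ n ] (ends ℓ n f ≡ (p , q) ⊎ ends ℓ n f ≡ (q , p)) × inStack f ≡ false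

  QueueEdge-sym : ∀ {p q} → QueueEdge p q → QueueEdge q p
  QueueEdge-sym (f , pq , queued) = f , swap pq , queued

  queueEdges-nonNested : ∀ {p₁ q₁ p₂ q₂} → QueueEdge p₁ q₁ → QueueEdge p₂ q₂ →
                         p₁ ≺ p₂ → p₂ ≺ q₂ → q₂ ≺ q₁ → ⊥
  queueEdges-nonNested (f , f-ends , f-queued) (g , g-ends , g-queued) p₁≺p₂ p₂≺q₂ q₂≺q₁ =
    queueOK f g f-queued g-queued
      ( _ , _ , _ , _
      , (f-ends , trans p₁≺p₂ (trans p₂≺q₂ q₂≺q₁)) , (g-ends , p₂≺q₂)
      , p₁≺p₂ , p₂≺q₂ , q₂≺q₁)

  module Interval {U V : Vert ℓ n} (U≺V : U ≺ V) where

    record CommonQueueNeighbour (x : Vert ℓ n) : Set where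
      field
        ≢U : x ≢ U
        ≢V : x ≢ V
        toU : QueueEdge x U
        toV : QueueEdge x V
    open CommonQueueNeighbour

    data Position (x : Vert ℓ n) : Set where
      left    : x ≺ U → Position x
      between : U ≺ x → x ≺ V → Position x
      right   : V ≺ x → Position x

    position : ∀ {x} → CommonQueueNeighbour x → Position x
    position {x} N with compare x U
    ... | tri< x≺U _ _ = left x≺U
    ... | tri≈ _ x≡U _ = ⊥-elim (≢U N x≡U)
    ... | tri> _ _ U≺x with compare x V
    ...   | tri< x≺V _ _ = between U≺x x≺V
    ...   | tri≈ _ x≡V _ = ⊥-elim (≢V N x≡V)
    ...   | tri> _ _ V≺x = right V≺x

    module _ {x y : Vert ℓ n} (x≢y : x ≢ y)
             (Nx : CommonQueueNeighbour x) (Ny : CommonQueueNeighbour y) where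

      not-both-left : x ≺ U → y ≺ U → ⊥
      not-both-left x≺U y≺U with compare x y
      ... | tri< x≺y _ _ = queueEdges-nonNested (toV Nx) (toU Ny) x≺y y≺U U≺V
      ... | tri≈ _ x≡y _ = x≢y x≡y
      ... | tri> _ _ y≺x = queueEdges-nonNested (toV Ny) (toU Nx) y≺x x≺U U≺V

      not-both-right : V ≺ x → V ≺ y → ⊥
      not-both-right V≺x V≺y with compare x y
      ... | tri< x≺y _ _ =
        queueEdges-nonNested (QueueEdge-sym (toU Ny)) (QueueEdge-sym (toV Nx)) U≺V V≺x x≺y
      ... | tri≈ _ x≡y _ = x≢y x≡y
      ... | tri> _ _ y≺x =
        queueEdges-nonNested (QueueEdge-sym (toU Nx)) (QueueEdge-sym (toV Ny)) U≺V V≺y y≺x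

    not-left-between : ∀ {x y} → CommonQueueNeighbour x → CommonQueueNeighbour y →
                       x ≺ U → U ≺ y → y ≺ V → ⊥
    not-left-between Nx Ny = queueEdges-nonNested (toV Nx) (QueueEdge-sym (toU Ny))

    not-between-right : ∀ {x y} → CommonQueueNeighbour x → CommonQueueNeighbour y →
                        U ≺ x → x ≺ V → V ≺ y → ⊥
    not-between-right Nx Ny = queueEdges-nonNested (QueueEdge-sym (toU Ny)) (toV Nx)

    left⇒right : ∀ {x y} → x ≢ y → CommonQueueNeighbour x → CommonQueueNeighbour y →
                 x ≺ U → V ≺ y
    left⇒right x≢y Nx Ny x≺U with position Ny
    ... | left y≺U         = ⊥-elim (not-both-left x≢y Nx Ny x≺U y≺U)
    ... | between U≺y y≺V  = ⊥-elim (not-left-between Nx Ny x≺U U≺y y≺V)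
    ... | right V≺y        = V≺y

    right⇒left : ∀ {x y} → x ≢ y → CommonQueueNeighbour x → CommonQueueNeighbour y →
                 V ≺ x → y ≺ U
    right⇒left x≢y Nx Ny V≺x with position Ny
    ... | left y≺U         = y≺U
    ... | between U≺y y≺V  = ⊥-elim (not-between-right Ny Nx U≺y y≺V V≺x)
    ... | right V≺y        = ⊥-elim (not-both-right x≢y Nx Ny V≺x V≺y)

    between-of-three : ∀ {x y z} → x ≢ y → x ≢ z → y ≢ z →
                       CommonQueueNeighbour x → CommonQueueNeighbour y → CommonQueueNeighbour z →
                       U ≺ x × x ≺ V
    between-of-three x≢y x≢z y≢z Nx Ny Nz with position Nx
    ... | between U≺x x≺V = U≺x , x≺V
    ... | left x≺U =
      ⊥-elim (not-both-right y≢z Ny Nz (left⇒right x≢y Nx Ny x≺U) (left⇒right x≢z Nx Nz x≺U))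
    ... | right V≺x =
      ⊥-elim (not-both-left y≢z Ny Nz (right⇒left x≢y Nx Ny V≺x) (right⇒left x≢z Nx Nz V≺x))

module _ {ℓ m : ℕ} (L : MixedLayout ℓ (suc m)) where
  open MixedLayout L using (_≺_)
  open QueueEdges L

  queueAttachment-commonQueueNeighbour :
    ∀ {e u v i} (u≺v : inj₁ u ≺ inj₁ v) → (ends ℓ m e ≡ (u , v) ⊎ ends ℓ m e ≡ (v , u)) →
    QueueAttachment L e i → Interval.CommonQueueNeighbour u≺v (inj₂ (e , i))
  queueAttachment-commonQueueNeighbour {e} {i = i} _ (inj₁ e-ends) (queued₀ , queued₁) = record
    { ≢U = λ () ; ≢V = λ ()
    ; toU = inj₂ (e , i , false) , inj₁ (cong (λ w → inj₂ (e , i) , inj₁ (proj₁ w)) e-ends) , queued₀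
    ; toV = inj₂ (e , i , true)  , inj₁ (cong (λ w → inj₂ (e , i) , inj₁ (proj₂ w)) e-ends) , queued₁
    }
  queueAttachment-commonQueueNeighbour {e} {i = i} _ (inj₂ e-ends) (queued₀ , queued₁) = record
    { ≢U = λ () ; ≢V = λ ()
    ; toU = inj₂ (e , i , true)  , inj₁ (cong (λ w → inj₂ (e , i) , inj₁ (proj₂ w)) e-ends) , queued₁
    ; toV = inj₂ (e , i , false) , inj₁ (cong (λ w → inj₂ (e , i) , inj₁ (proj₁ w)) e-ends) , queued₀
    }

attachments-distinct : ∀ {ℓ m} {e : Edge ℓ m} {i j : Fin ℓ} →
                       i ≢ j → inj₂ {A = Vert ℓ m} (e , i) ≢ inj₂ (e , j)
attachments-distinct i≢j refl = i≢j refl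

lemma3 : (k ℓ : ℕ) → 1 < k → 2 < ℓ → (m : ℕ) → k ≡ suc (suc m) →
    (L : MixedLayout ℓ (suc m)) →
    (e : Edge ℓ m) (u v : Vert ℓ m) →
    (ends ℓ m e ≡ (u , v) ⊎ ends ℓ m e ≡ (v , u)) →
    MixedLayout._≺_ L (inj₁ u) (inj₁ v) →
    (a b c : Fin ℓ) → a ≢ b → a ≢ c → b ≢ c →
    QueueAttachment L e a → QueueAttachment L e b → QueueAttachment L e c →
    (MixedLayout._≺_ L (inj₁ u) (inj₂ (e , a)) × MixedLayout._≺_ L (inj₂ (e , a)) (inj₁ v)) ×
    (MixedLayout._≺_ L (inj₁ u) (inj₂ (e , b)) × MixedLayout._≺_ L (inj₂ (e , b)) (inj₁ v)) ×
    (MixedLayout._≺_ L (inj₁ u) (inj₂ (e , c)) × MixedLayout._≺_ L (inj₂ (e , c)) (inj₁ v))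
lemma3 _ _ _ _ _ _ L e u v e-ends u≺v a b c a≢b a≢c b≢c qa qb qc =
    between-of-three ab ac bc (N qa) (N qb) (N qc)
  , between-of-three (≢-sym ab) bc ac (N qb) (N qa) (N qc)
  , between-of-three (≢-sym ac) (≢-sym bc) ab (N qc) (N qa) (N qb)
  where
  open QueueEdges.Interval L u≺v using (CommonQueueNeighbour; between-of-three)

  N : ∀ {i} → QueueAttachment L e i → CommonQueueNeighbour (inj₂ (e , i))
  N = queueAttachment-commonQueueNeighbour L u≺v e-ends

  ab : inj₂ (e , a) ≢ inj₂ (e , b)
  ab = attachments-distinct a≢b
  ac : inj₂ (e , a) ≢ inj₂ (e , c)
  ac = attachments-distinct a≢c
  bc : inj₂ (e , b) ≢ inj₂ (e , c)
  bc = attachments-distinct b≢c
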